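{- For every Hamiltonian cubic graph $G$, ${\rm ch}_i(G)\le 6$.
   Context: All graphs are finite, simple and undirected. An incidence of $G$ is a pair $(v,e)$ with $v$ a vertex and $e$ an edge incident with $v$, written $(v,vu)$ when $e=vu$. Two incidences $(v,e)$, $(w,f)$ are adjacent if $v=w$, or $e=f$, or the edge $vw$ equals $e$ or $f$. For a list assignment $L$ (a finite set $L(v,e)$ of colours for each incidence), $G$ is $L$-list incidence colourable if there is a map $\sigma$ with $\sigma(v,e)\in L(v,e)$ and adjacent incidences receiving distinct colours. ${\rm ch}_i(G)$ (incidence choice number) is the least $k$ such that $G$ is $L$-list incidence colourable for every $L$ with all lists of size $k$. -}

module Defs where

open import Data.Nat using (ℕ; zero; suc; _≤_)
open import Data.Fin using (Fin; toℕ)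
open import Data.Fin.Properties using (_≟_)
open import Data.Bool using (Bool; T)
open import Data.Bool.Properties using (T?)
open import Data.List using (List; length; filter; allFin)
open import Data.List.Membership.Propositional using (_∈_)
open import Data.List.Relation.Unary.Unique.Propositional using (Unique)
open import Data.Product using (Σ; ∃; _×_; _,_)
open import Data.Sum using (_⊎_)
open import Relation.Binary.PropositionalEquality using (_≡_; _≢_)
open import Relation.Nullary using (¬_)
open import Function.Definitions using (Injective)

record Graph : Set where
  field
    n      : ℕ
    adj    : Fin n → Fin n → Bool
    sym    : ∀ u v → adj u v ≡ adj v u
    irrefl : ∀ v → adj v v ≡ Bool.false

open Graph public

Edge : (G : Graph) → Fin (n G) → Fin (n G) → Set
Edge G u v = T (adj G u v)

degree : (G : Graph) → Fin (n G) → ℕ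
degree G v = length (filter (λ u → T? (adj G v u)) (allFin (n G)))

Cubic : Graph → Set
Cubic G = ∀ v → degree G v ≡ 3

-- A Hamiltonian cycle: an injective (hence bijective) enumeration c of all
-- vertices such that consecutive vertices (cyclically) are adjacent.
Hamiltonian : Graph → Set
Hamiltonian G =
  3 ≤ n G ×
  Σ (Fin (n G) → Fin (n G)) λ c →
    Injective _≡_ _≡_ c ×
    (∀ i j → (suc (toℕ i) ≡ toℕ j ⊎ (suc (toℕ i) ≡ n G × toℕ j ≡ 0)) →
       Edge G (c i) (c j))

record Incidence (G : Graph) : Set where
  constructor inc
  field
    vtx   : Fin (n G)
    other : Fin (n G)
    edge  : Edge G vtx other

open Incidence public

-- Incidences (v,vu) and (w,wx) are adjacent iff they are distinct and
-- v = w, or the edges coincide, or the edge vw equals vu (i.e. w = u)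
-- or equals wx (i.e. x = v).  (Equality of edges vu = wx with v ≠ w
-- forces w = u, so that case is subsumed.)
AdjInc : (G : Graph) → Incidence G → Incidence G → Set
AdjInc G (inc v u _) (inc w x _) =
  ¬ (v ≡ w × u ≡ x) ×
  (v ≡ w ⊎ (v ≡ x × u ≡ w) ⊎ w ≡ u ⊎ x ≡ v)

-- Colours are natural numbers; a list assignment gives each incidence a
-- finite set of colours, represented as a duplicate-free list.
ListAssignment : Graph → Set
ListAssignment G = Incidence G → List ℕ

ListIncidenceColourable : (G : Graph) → ListAssignment G → Set
ListIncidenceColourable G L =
  Σ (Incidence G → ℕ) λ σ →
    (∀ i → σ i ∈ L i) ×
    (∀ i j → AdjInc G i j → σ i ≢ σ j)

IncidenceChoosable : Graph → ℕ → Set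
IncidenceChoosable G k =
  ∀ (L : ListAssignment G) →
    (∀ i → Unique (L i) × length (L i) ≡ k) →
    ListIncidenceColourable G L

-- ch_i(G) ≤ k : the least k' with G incidence k'-choosable is at most k,
-- i.e. some k' ≤ k works.
ChI≤ : Graph → ℕ → Set
ChI≤ G k = ∃ λ k' → k' ≤ k × IncidenceChoosable G k'

module Submission where

-- Number the vertices 0, …, n−1 along the Hamiltonian cycle. Every vertex i then has a forward
-- neighbour i+1, a backward neighbour i−1 and a chord partner, so the incidences are the arcs (i , d)
-- with d ∈ {fwd, bwd, chd}, and every arc conflicts with exactly seven others. Colour the arcs
-- greedily from vertex n−1 down to vertex 0: an arc away from vertex 0 still has two uncoloured
-- conflicting arcs when its turn comes, so one of its six colours is free. At vertex 0 this fails,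
-- and it is repaired by precolouring. The three arcs entering 0 receive colours of which at most one
-- lies in the list of (0 , bwd) and at most two in that of (0 , fwd) (choose-three). This makes one
-- arc X at vertex 1 lose an uncoloured neighbour, so two other neighbours of X are precoloured with
-- colours that coincide within the list of X (choose-pair). Which arcs these are depends on whether
-- the chord at 0 goes to 2.

open import Data.Nat as ℕ using (ℕ; zero; suc; _+_; _*_; _∸_; _<_; _≤_; s≤s; z≤n)
open import Data.Nat.Properties
  using ( +-cancelˡ-≤; +-monoˡ-≤; +-mono-≤; +-monoʳ-<; ≤-<-trans; <-≤-trans; ≤-trans; ≤-reflexive; ≤-refl; ≤-pred
        ; m≤n+m; m≤m+n; <⇒≱; <⇒≤; <-asym; <-cmp; _<?_; n<1+n; 0≢1+n; suc-injective
        ; ∸-monoʳ-<; ∸-cancelˡ-≡; +-commutativeSemigroup; module ≤-Reasoning)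
open import Algebra.Properties.CommutativeSemigroup +-commutativeSemigroup using (interchange)
open import Data.Bool using (Bool; false; T)
open import Data.Bool.Properties using (T?; T-irrelevant)
open import Data.Fin using (Fin; zero; suc; toℕ; fromℕ; inject₁; lower₁; #_)
open import Data.Fin.Properties
  using (toℕ-injective; toℕ-fromℕ; toℕ-inject₁; toℕ-inject₁-≢; toℕ-lower₁; inject₁-lower₁; lower₁-inject₁′; toℕ<n)
  renaming (_≟_ to _≟ᶠ_)
open import Data.Vec using (Vec; []; _∷_; lookup)
open import Data.List using (List; []; _∷_; _++_; map; filter; length; allFin)
open import Data.List.Properties using (filter-notAll; length-++; length-map; length-tabulate; map-cong-local)
open import Data.List.Membership.Propositional using (_∈_; _∉_; find)
open import Data.List.Membership.Propositional.Properties
  using (∈-map⁺; ∈-map⁻; ∈-filter⁺; ∈-filter⁻; ∈-++⁺ˡ; ∈-++⁺ʳ; ∈-++⁻; ∈-allFin)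
open import Data.List.Relation.Binary.Subset.Propositional using (_⊆_)
open import Data.List.Relation.Binary.Disjoint.Propositional using (Disjoint)
open import Data.List.Relation.Unary.Any as Any using (Any; here; there; any?)
open import Data.List.Relation.Unary.All as All using (All; []; _∷_)
open import Data.List.Relation.Unary.AllPairs using (AllPairs; []; _∷_)
open import Data.List.Relation.Unary.Unique.Propositional using (Unique)
open import Data.List.Relation.Unary.Unique.Propositional.Properties using (filter⁺; ++⁺; map⁺; allFin⁺)
open import Data.Product using (Σ; ∃; _×_; _,_; proj₁; proj₂)
open import Data.Product.Properties using (≡-dec)
open import Data.Sum using (_⊎_; inj₁; inj₂)
open import Data.Empty using (⊥-elim)
open import Function using (_∘_; id)
open import Function.Definitions using (Injective)
open import Relation.Binary.Definitions using (DecidableEquality; tri<; tri≈; tri>)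
open import Relation.Binary.PropositionalEquality using (_≡_; _≢_; refl; sym; trans; cong; cong₂; subst; subst₂)
open import Relation.Nullary using (¬_; Dec; yes; no; ¬?; contradiction)
open import Relation.Nullary.Decidable using (_×-dec_)
open import Defs hiding (sym)

module Counting {A : Set} (_≟_ : DecidableEquality A) where

  _∈?_ : ∀ x ys → Dec (x ∈ ys)
  x ∈? ys = any? (x ≟_) ys

  _∖_ : List A → List A → List A
  L ∖ D = filter (λ y → ¬? (y ∈? D)) L

  ∈-∖⁺ : ∀ {y L D} → y ∈ L → y ∉ D → y ∈ L ∖ D
  ∈-∖⁺ = ∈-filter⁺ (λ y → ¬? (y ∈? _))

  ∈-∖⁻ : ∀ {y} L D → y ∈ L ∖ D → y ∈ L × y ∉ D
  ∈-∖⁻ L D = ∈-filter⁻ (λ y → ¬? (y ∈? D)) {xs = L}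

  length-∖-< : ∀ {x ys} → x ∈ ys → length (ys ∖ (x ∷ [])) < length ys
  length-∖-< x∈ys = filter-notAll _ _ (Any.map (λ x≡y y∉x → y∉x (here (sym x≡y))) x∈ys)

  ∈-∖-singleton : ∀ {x y ys} → y ∈ ys → y ≢ x → y ∈ ys ∖ (x ∷ [])
  ∈-∖-singleton y∈ys y≢x = ∈-∖⁺ y∈ys λ { (here y≡x) → y≢x y≡x }

  length-mono-⊆ : ∀ {xs ys} → Unique xs → xs ⊆ ys → length xs ≤ length ys
  length-mono-⊆ {[]}     _              _     = z≤n
  length-mono-⊆ {x ∷ xs} {ys} (x≢xs ∷ uniq) xs⊆ys =
    ≤-trans (s≤s (length-mono-⊆ uniq xs⊆ys-x)) (length-∖-< (xs⊆ys (here refl)))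
    where
    xs⊆ys-x : xs ⊆ ys ∖ (x ∷ [])
    xs⊆ys-x y∈xs = ∈-∖-singleton (xs⊆ys (there y∈xs)) (λ y≡x → All.lookup x≢xs y∈xs (sym y≡x))

  ⊆-flip-if-not-longer : ∀ {xs ys} → Unique xs → length ys ≤ length xs → xs ⊆ ys → ys ⊆ xs
  ⊆-flip-if-not-longer {xs} {ys} uniq ys≤xs xs⊆ys {y} y∈ys with y ∈? xs
  ... | yes y∈xs = y∈xs
  ... | no  y∉xs = contradiction (length-mono-⊆ uniq xs⊆ys-y) (<⇒≱ (<-≤-trans (length-∖-< y∈ys) ys≤xs))
    where
    xs⊆ys-y : xs ⊆ ys ∖ (y ∷ [])
    xs⊆ys-y x∈xs = ∈-∖-singleton (xs⊆ys x∈xs) (λ { refl → y∉xs x∈xs })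

  ⊆-if-none-outside : ∀ {xs ys} → ¬ Any (_∉ ys) xs → xs ⊆ ys
  ⊆-if-none-outside {ys = ys} none {x} x∈xs with x ∈? ys
  ... | yes x∈ys = x∈ys
  ... | no  x∉ys = contradiction (Any.map (λ { refl → x∉ys }) x∈xs) none

  pigeonhole : ∀ {xs ys} → Unique xs → length ys < length xs → ∃ λ x → x ∈ xs × x ∉ ys
  pigeonhole {xs} {ys} uniq ys<xs with any? (λ x → ¬? (x ∈? ys)) xs
  ... | yes some∉ys = find some∉ys
  ... | no  none∉ys = contradiction (length-mono-⊆ uniq (⊆-if-none-outside none∉ys)) (<⇒≱ ys<xs)

  _⊆_within_ : List A → List A → List A → Set
  F ⊆ F′ within L = ∀ {y} → y ∈ L → y ∈ F → y ∈ F′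

  UniqueOfLength : ℕ → List A → Set
  UniqueOfLength k L = Unique L × length L ≡ k

  element-avoiding : ∀ {k L} D → UniqueOfLength k L → length D < k → ∃ λ y → y ∈ L × y ∉ D
  element-avoiding D (uniq , refl) D<k = pigeonhole uniq D<k

  free-element : ∀ {k L F} F′ → UniqueOfLength k L → length F′ < k → F ⊆ F′ within L →
                 ∃ λ y → y ∈ L × y ∉ F
  free-element F′ uL F′<k F⊆F′ with element-avoiding F′ uL F′<k
  ... | y , y∈L , y∉F′ = y , y∈L , λ y∈F → y∉F′ (F⊆F′ y∈L y∈F)

  all⇒⊆-within : ∀ {ys R L} → All (λ y → y ∈ L → y ∈ R) ys → ys ⊆ R within L
  all⇒⊆-within all y∈L y∈ys = All.lookup all y∈ys y∈L

  element-outside : ∀ {k X S c} → UniqueOfLength k X → UniqueOfLength k S → c ∈ S → c ∉ X →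
                    ∃ λ o → o ∈ X × o ∉ S
  element-outside {S = S} {c} uX (_ , refl) c∈S c∉X with element-avoiding (S ∖ (c ∷ [])) uX (length-∖-< c∈S)
  ... | o , o∈X , o∉S-c = o , o∈X , λ o∈S → o∉S-c (∈-∖-singleton o∈S λ { refl → c∉X o∈X })

  prefer : ∀ {k X S c} → UniqueOfLength k X → UniqueOfLength k S → c ∈ S →
           ∃ λ y → y ∈ X × (y ∈ S → y ≡ c) × (c ∈ X → y ≡ c)
  prefer {X = X} {c = c} uX uS c∈S with c ∈? X
  ... | yes c∈X = c , c∈X , (λ _ → refl) , (λ _ → refl)
  ... | no  c∉X with element-outside uX uS c∈S c∉X
  ...   | o , o∈X , o∉S = o , o∈X , (λ o∈S → contradiction o∈S o∉S) , (λ c∈X → contradiction c∈X c∉X)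

  record ThreeChoice (S T X₁ X₂ X₃ : List A) : Set where
    constructor three-choice
    field
      y₁ y₂ y₃ : A
      y₁∈X₁ : y₁ ∈ X₁
      y₂∈X₂ : y₂ ∈ X₂
      y₃∈X₃ : y₃ ∈ X₃
      s t₁ t₂ : A
      one-in-S : (y₁ ∷ y₂ ∷ y₃ ∷ []) ⊆ (s ∷ []) within S
      two-in-T : (y₁ ∷ y₂ ∷ y₃ ∷ []) ⊆ (t₁ ∷ t₂ ∷ []) within T

  within₃ : ∀ {y₁ y₂ y₃ R L} →
            (y₁ ∈ L → y₁ ∈ R) → (y₂ ∈ L → y₂ ∈ R) → (y₃ ∈ L → y₃ ∈ R) → (y₁ ∷ y₂ ∷ y₃ ∷ []) ⊆ R within L
  within₃ p₁ p₂ p₃ = all⇒⊆-within (p₁ ∷ p₂ ∷ p₃ ∷ [])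

  choose-three-off-S : ∀ {k S T X₁ X₂ X₃ y₁ y₂ y₃} → UniqueOfLength k T → UniqueOfLength k X₂ →
                       y₁ ∈ X₁ → y₂ ∈ X₂ → y₃ ∈ X₃ → y₁ ∉ S → y₂ ∉ S → y₃ ∉ S →
                       ThreeChoice S T X₁ X₂ X₃
  choose-three-off-S {T = T} {X₁} {X₂} {y₁ = y₁} {y₂} {y₃} uT u₂ y₁∈ y₂∈ y₃∈ y₁∉S y₂∉S y₃∉S
    with any? (λ e → ¬? (e ∈? T)) X₁ | any? (λ e → ¬? (e ∈? T)) X₂
  ... | yes X₁⊈T | _ with find X₁⊈T
  ...   | e , e∈X₁ , e∉T = three-choice e y₂ y₃ e∈X₁ y₂∈ y₃∈ e y₂ y₃
          (within₃ (λ _ → here refl) (⊥-elim ∘ y₂∉S) (⊥-elim ∘ y₃∉S))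
          (within₃ (⊥-elim ∘ e∉T) (λ _ → here refl) (λ _ → there (here refl)))
  choose-three-off-S {y₁ = y₁} {y₂} {y₃} uT u₂ y₁∈ y₂∈ y₃∈ y₁∉S y₂∉S y₃∉S | no _ | yes X₂⊈T
    with find X₂⊈T
  ...   | e , e∈X₂ , e∉T = three-choice y₁ e y₃ y₁∈ e∈X₂ y₃∈ e y₁ y₃
          (within₃ (⊥-elim ∘ y₁∉S) (λ _ → here refl) (⊥-elim ∘ y₃∉S))
          (within₃ (λ _ → here refl) (⊥-elim ∘ e∉T) (λ _ → there (here refl)))
  choose-three-off-S {y₁ = y₁} {y₂} {y₃} uT u₂ y₁∈ y₂∈ y₃∈ y₁∉S y₂∉S y₃∉S | no X₁⊆T | no X₂⊆T =
    three-choice y₁ y₁ y₃ y₁∈ y₁∈X₂ y₃∈ y₁ y₁ y₃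
      (within₃ (⊥-elim ∘ y₁∉S) (⊥-elim ∘ y₁∉S) (⊥-elim ∘ y₃∉S))
      (within₃ (λ _ → here refl) (λ _ → here refl) (λ _ → there (here refl)))
    where
    y₁∈X₂ : y₁ ∈ _
    y₁∈X₂ = ⊆-flip-if-not-longer (proj₁ u₂) (≤-reflexive (trans (proj₂ uT) (sym (proj₂ u₂))))
                                 (⊆-if-none-outside X₂⊆T) (⊆-if-none-outside X₁⊆T y₁∈)

  choose-three : ∀ {k S T X₁ X₂ X₃} → UniqueOfLength (suc k) S → UniqueOfLength (suc k) T →
                 UniqueOfLength (suc k) X₁ → UniqueOfLength (suc k) X₂ → UniqueOfLength (suc k) X₃ →
                 ThreeChoice S T X₁ X₂ X₃
  choose-three {S = S} {T} uS uT u₁ u₂ u₃ with any? (λ a → ¬? (a ∈? T)) S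
  choose-three {S = c ∷ _} {T} uS uT u₁ u₂ u₃ | no S⊆T
    with prefer u₁ uS (here refl) | prefer u₂ uS (here refl) | prefer u₃ uS (here refl)
  ... | y₁ , y₁∈ , inS₁ , _ | y₂ , y₂∈ , inS₂ , _ | y₃ , y₃∈ , inS₃ , _ =
    three-choice y₁ y₂ y₃ y₁∈ y₂∈ y₃∈ c c c
      (within₃ (here ∘ inS₁) (here ∘ inS₂) (here ∘ inS₃))
      (within₃ (here ∘ inS₁ ∘ T⊆S) (here ∘ inS₂ ∘ T⊆S) (here ∘ inS₃ ∘ T⊆S))
    where
    T⊆S : T ⊆ c ∷ _
    T⊆S = ⊆-flip-if-not-longer (proj₁ uS) (≤-reflexive (trans (proj₂ uT) (sym (proj₂ uS))))
                               (⊆-if-none-outside S⊆T)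
  choose-three {S = S} {T} {X₁} {X₂} {X₃} uS uT u₁ u₂ u₃ | yes S⊈T
    with find S⊈T
  ... | d , d∈S , d∉T
    with prefer u₁ uS d∈S | prefer u₂ uS d∈S | prefer u₃ uS d∈S
  ... | y₁ , y₁∈ , inS₁ , is₁ | y₂ , y₂∈ , inS₂ , is₂ | y₃ , y₃∈ , inS₃ , is₃
    with d ∈? X₁ | d ∈? X₂ | d ∈? X₃
  ... | yes d∈X₁ | _ | _ = three-choice y₁ y₂ y₃ y₁∈ y₂∈ y₃∈ d y₂ y₃
      (within₃ (here ∘ inS₁) (here ∘ inS₂) (here ∘ inS₃))
      (within₃ (λ y∈T → contradiction (subst (_∈ T) (is₁ d∈X₁) y∈T) d∉T)
               (λ _ → here refl) (λ _ → there (here refl)))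
  ... | no _ | yes d∈X₂ | _ = three-choice y₁ y₂ y₃ y₁∈ y₂∈ y₃∈ d y₁ y₃
      (within₃ (here ∘ inS₁) (here ∘ inS₂) (here ∘ inS₃))
      (within₃ (λ _ → here refl) (λ y∈T → contradiction (subst (_∈ T) (is₂ d∈X₂) y∈T) d∉T)
               (λ _ → there (here refl)))
  ... | no _ | no _ | yes d∈X₃ = three-choice y₁ y₂ y₃ y₁∈ y₂∈ y₃∈ d y₁ y₂
      (within₃ (here ∘ inS₁) (here ∘ inS₂) (here ∘ inS₃))
      (within₃ (λ _ → here refl) (λ _ → there (here refl))
               (λ y∈T → contradiction (subst (_∈ T) (is₃ d∈X₃) y∈T) d∉T))
  ... | no d∉X₁ | no d∉X₂ | no d∉X₃ = choose-three-off-S uT u₂ y₁∈ y₂∈ y₃∈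
      (λ y∈S → d∉X₁ (subst (_∈ X₁) (inS₁ y∈S) y₁∈))
      (λ y∈S → d∉X₂ (subst (_∈ X₂) (inS₂ y∈S) y₂∈))
      (λ y∈S → d∉X₃ (subst (_∈ X₃) (inS₃ y∈S) y₃∈))

  record PairChoice (X Lp Lq Dp Dq : List A) : Set where
    constructor pair-choice
    field
      yp yq : A
      yp∈Lp : yp ∈ Lp
      yp∉Dp : yp ∉ Dp
      yq∈Lq : yq ∈ Lq
      yq∉Dq : yq ∉ Dq
      r : A
      one-in-X : (yp ∷ yq ∷ []) ⊆ (r ∷ []) within X

  length-≤-∖-++ : ∀ {L} D → Unique L → length L ≤ length (L ∖ D) + length D
  length-≤-∖-++ {L} D uniq = ≤-trans (length-mono-⊆ uniq L⊆) (≤-reflexive (length-++ (L ∖ D)))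
    where
    L⊆ : L ⊆ (L ∖ D) ++ D
    L⊆ {y} y∈L with y ∈? D
    ... | yes y∈D = ∈-++⁺ʳ _ y∈D
    ... | no  y∉D = ∈-++⁺ˡ (∈-∖⁺ y∈L y∉D)

  disjoint-remainders : ∀ {k X Lp Lq} Dp Dq → UniqueOfLength k X → UniqueOfLength k Lp → UniqueOfLength k Lq →
                        (Lp ∖ Dp) ++ (Lq ∖ Dq) ⊆ X → Disjoint (Lp ∖ Dp) (Lq ∖ Dq) → k ≤ length Dp + length Dq
  disjoint-remainders {k} {X} {Lp} {Lq} Dp Dq (uX , lX) (uP , lP) (uQ , lQ) R⊆X disjoint =
    +-cancelˡ-≤ k _ _ (begin
      k + k                                             ≤⟨ +-mono-≤ Lp≤ Lq≤ ⟩
      (length Rp + length Dp) + (length Rq + length Dq) ≡⟨ interchange (length Rp) (length Dp) (length Rq) (length Dq) ⟩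
      (length Rp + length Rq) + (length Dp + length Dq) ≤⟨ +-monoˡ-≤ (length Dp + length Dq) R≤ ⟩
      k + (length Dp + length Dq)                       ∎)
    where
    open ≤-Reasoning
    Rp = Lp ∖ Dp
    Rq = Lq ∖ Dq
    Lp≤ : k ≤ length Rp + length Dp
    Lp≤ = subst (_≤ length Rp + length Dp) lP (length-≤-∖-++ Dp uP)
    Lq≤ : k ≤ length Rq + length Dq
    Lq≤ = subst (_≤ length Rq + length Dq) lQ (length-≤-∖-++ Dq uQ)
    R≤ : length Rp + length Rq ≤ k
    R≤ = subst₂ _≤_ (length-++ Rp) lX (length-mono-⊆ (++⁺ (filter⁺ _ uP) (filter⁺ _ uQ) disjoint) R⊆X)

  choose-pair : ∀ {k X Lp Lq Dp Dq} → UniqueOfLength k X → UniqueOfLength k Lp → UniqueOfLength k Lq →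
                length Dp + length Dq < k → PairChoice X Lp Lq Dp Dq
  choose-pair {k} {X} {Lp} {Lq} {Dp} {Dq} uX uP uQ D<k
    with any? (λ e → ¬? (e ∈? Dp) ×-dec (e ∈? (Lq ∖ Dq))) Lp
  ... | yes common with find common
  ...   | e , e∈Lp , e∉Dp , e∈Rq with ∈-∖⁻ Lq Dq e∈Rq
  ...     | e∈Lq , e∉Dq =
    pair-choice e e e∈Lp e∉Dp e∈Lq e∉Dq e (all⇒⊆-within ((λ _ → here refl) ∷ (λ _ → here refl) ∷ []))
  choose-pair {k} {X} {Lp} {Lq} {Dp} {Dq} uX uP uQ D<k | no no-common
    with any? (λ e → ¬? (e ∈? X)) (Lp ∖ Dp) | any? (λ e → ¬? (e ∈? X)) (Lq ∖ Dq)
  ... | yes p-off | _ with find p-off | element-avoiding Dq uQ (≤-<-trans (m≤n+m (length Dq) (length Dp)) D<k)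
  ...   | e , e∈Rp , e∉X | q , q∈Lq , q∉Dq with ∈-∖⁻ Lp Dp e∈Rp
  ...     | e∈Lp , e∉Dp =
    pair-choice e q e∈Lp e∉Dp q∈Lq q∉Dq q (all⇒⊆-within ((⊥-elim ∘ e∉X) ∷ (λ _ → here refl) ∷ []))
  choose-pair {k} {X} {Lp} {Lq} {Dp} {Dq} uX uP uQ D<k | no no-common | no _ | yes q-off
    with find q-off | element-avoiding Dp uP (≤-<-trans (m≤m+n (length Dp) (length Dq)) D<k)
  ...   | e , e∈Rq , e∉X | p , p∈Lp , p∉Dp with ∈-∖⁻ Lq Dq e∈Rq
  ...     | e∈Lq , e∉Dq =
    pair-choice p e p∈Lp p∉Dp e∈Lq e∉Dq p (all⇒⊆-within ((λ _ → here refl) ∷ (⊥-elim ∘ e∉X) ∷ []))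
  choose-pair {k} {X} {Lp} {Lq} {Dp} {Dq} uX uP uQ D<k | no no-common | no p-in | no q-in =
    contradiction (disjoint-remainders Dp Dq uX uP uQ R⊆X disjoint) (<⇒≱ D<k)
    where
    R⊆X : (Lp ∖ Dp) ++ (Lq ∖ Dq) ⊆ X
    R⊆X y∈ with ∈-++⁻ (Lp ∖ Dp) y∈
    ... | inj₁ y∈Rp = ⊆-if-none-outside p-in y∈Rp
    ... | inj₂ y∈Rq = ⊆-if-none-outside q-in y∈Rq
    disjoint : Disjoint (Lp ∖ Dp) (Lq ∖ Dq)
    disjoint (y∈Rp , y∈Rq) with ∈-∖⁻ Lp Dp y∈Rp
    ... | y∈Lp , y∉Dp = no-common (Any.map (λ { refl → y∉Dp , y∈Rq }) y∈Lp)

allPairs-lookup : ∀ {A : Set} {R : A → A → Set} {xs x y} → AllPairs R xs → x ∈ xs → y ∈ xs →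
                  x ≡ y ⊎ R x y ⊎ R y x
allPairs-lookup (_   ∷ _)   (here refl) (here refl) = inj₁ refl
allPairs-lookup (Rx ∷ _)    (here refl) (there y∈)  = inj₂ (inj₁ (All.lookup Rx y∈))
allPairs-lookup (Ry ∷ _)    (there x∈)  (here refl) = inj₂ (inj₂ (All.lookup Ry x∈))
allPairs-lookup (_  ∷ rest) (there x∈)  (there y∈)  = allPairs-lookup rest x∈ y∈

keys-functional : ∀ {A B : Set} {P : List (A × B)} {a y y′} → Unique (map proj₁ P) →
                  (a , y) ∈ P → (a , y′) ∈ P → y ≡ y′
keys-functional _                  (here refl) (here refl) = refl
keys-functional (a∉ ∷ _)           (here refl) (there p∈)  = ⊥-elim (All.lookup a∉ (∈-map⁺ proj₁ p∈) refl)
keys-functional (a∉ ∷ _)           (there p∈)  (here refl) = ⊥-elim (All.lookup a∉ (∈-map⁺ proj₁ p∈) refl)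
keys-functional (_  ∷ uniq)        (there p∈)  (there q∈)  = keys-functional uniq p∈ q∈

open Counting ℕ._≟_

module _ {K : ℕ} where

  next : Fin (suc K) → Fin (suc K)
  next i with K ℕ.≟ toℕ i
  ... | yes _   = zero
  ... | no  K≢i = suc (lower₁ i K≢i)

  prev : Fin (suc K) → Fin (suc K)
  prev zero    = fromℕ K
  prev (suc i) = inject₁ i

  prev-next : ∀ i → prev (next i) ≡ i
  prev-next i with K ℕ.≟ toℕ i
  ... | yes K≡i = toℕ-injective (trans (toℕ-fromℕ K) K≡i)
  ... | no  K≢i = inject₁-lower₁ i K≢i

  next-prev : ∀ i → next (prev i) ≡ i
  next-prev zero with K ℕ.≟ toℕ (fromℕ K)
  ... | yes _   = refl
  ... | no  K≢K = contradiction (sym (toℕ-fromℕ K)) K≢K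
  next-prev (suc i) with K ℕ.≟ toℕ (inject₁ i)
  ... | yes K≡i = contradiction K≡i (toℕ-inject₁-≢ i)
  ... | no  K≢i = cong suc (lower₁-inject₁′ i K≢i)

  prev-injective : ∀ {i j} → prev i ≡ prev j → i ≡ j
  prev-injective {i} {j} eq = trans (sym (next-prev i)) (trans (cong next eq) (next-prev j))

  next-step : ∀ i → suc (toℕ i) ≡ toℕ (next i) ⊎ (suc (toℕ i) ≡ suc K × toℕ (next i) ≡ 0)
  next-step i with K ℕ.≟ toℕ i
  ... | yes K≡i = inj₂ (cong suc (sym K≡i) , refl)
  ... | no  K≢i = inj₁ (cong suc (sym (toℕ-lower₁ i K≢i)))

  key : Fin (suc K) → ℕ
  key i = suc K ∸ toℕ i

  key-injective : ∀ {i j} → key i ≡ key j → i ≡ j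
  key-injective {i} {j} eq = toℕ-injective (∸-cancelˡ-≡ (<⇒≤ (toℕ<n i)) (<⇒≤ (toℕ<n j)) eq)

  key-antitone : ∀ {i j} → toℕ j < toℕ i → key i < key j
  key-antitone {i} j<i = ∸-monoʳ-< j<i (<⇒≤ (toℕ<n i))

  key-<-prev : ∀ {i} → i ≢ zero → key i < key (prev i)
  key-<-prev {zero}  i≢0 = contradiction refl i≢0
  key-<-prev {suc i} _   = key-antitone {suc i} (s≤s (≤-reflexive (toℕ-inject₁ i)))

  key-<-zero : ∀ {i} → i ≢ zero → key i < key zero
  key-<-zero {zero}  i≢0 = contradiction refl i≢0
  key-<-zero {suc i} _   = key-antitone {suc i} (s≤s z≤n)

key-<-one : ∀ {K} {i : Fin (2 + K)} → i ≢ zero → i ≢ suc zero → key i < key {suc K} (suc zero)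
key-<-one {i = zero}        i≢0 _   = contradiction refl i≢0
key-<-one {i = suc zero}    _   i≢1 = contradiction refl i≢1
key-<-one {i = suc (suc i)} _   _   = key-antitone {i = suc (suc i)} (s≤s (s≤s z≤n))

next-next-≢ : ∀ {N} (i : Fin (3 + N)) → next (next i) ≢ i
next-next-≢ {N} i eq with next-step i | next-step (next i)
... | inj₁ s₁ | inj₁ s₂ = x≢2+x (trans (cong toℕ (sym eq)) (sym (trans (cong suc s₁) s₂)))
  where
  x≢2+x : ∀ {x} → x ≢ suc (suc x)
  x≢2+x ()
... | inj₁ s₁ | inj₂ (j≡K , nn≡0) = 1≢2+N (trans (cong suc i≡0) (trans s₁ (suc-injective j≡K)))
  where
  i≡0 : 0 ≡ toℕ i
  i≡0 = trans (sym nn≡0) (cong toℕ eq)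
  1≢2+N : 1 ≢ suc (suc N)
  1≢2+N ()
... | inj₂ (i≡K , j≡0) | inj₁ s₂ =
  1≢2+N (trans (trans (cong suc (sym j≡0)) s₂) (trans (cong toℕ eq) (suc-injective i≡K)))
  where
  1≢2+N : 1 ≢ suc (suc N)
  1≢2+N ()
... | inj₂ (_ , j≡0) | inj₂ (j≡K , _) = 0≢1+n (trans (sym j≡0) (suc-injective j≡K))

firstFree : List ℕ → List ℕ → ℕ
firstFree []      F = 0
firstFree (x ∷ C) F with x ∈? F
... | yes _ = firstFree C F
... | no  _ = x

firstFree-free : ∀ C F → (∃ λ y → y ∈ C × y ∉ F) → firstFree C F ∈ C × firstFree C F ∉ F
firstFree-free (x ∷ C) F (y , y∈ , y∉) with x ∈? F
firstFree-free (x ∷ C) F (y , here refl , y∉)  | yes x∈F = contradiction x∈F y∉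
firstFree-free (x ∷ C) F (y , there y∈C , y∉) | yes _ with firstFree-free C F (y , y∈C , y∉)
... | ∈C , ∉F = there ∈C , ∉F
firstFree-free (x ∷ C) F _ | no x∉F = here refl , x∉F

module Greedy {Arc : Set} (_≟ᵃ_ : DecidableEquality Arc) {d : ℕ}
  (Conflict : Arc → Arc → Set) (conflict-sym : ∀ {a b} → Conflict a b → Conflict b a)
  (nbrs : Arc → Vec Arc d) (nbrs-complete : ∀ {a b} → a ≢ b → Conflict a b → ∃ λ j → lookup (nbrs a) j ≡ b)
  (rank : Arc → ℕ) (rank-injective : ∀ {a b} → rank a ≡ rank b → a ≡ b)
  (L : Arc → List ℕ) (P : List (Arc × ℕ)) where
  private
    module A = Counting _≟ᵃ_
    module J = Counting (_≟ᶠ_ {d})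

  neighbour : Arc → Fin d → Arc
  neighbour a = lookup (nbrs a)

  keys : List Arc
  keys = map proj₁ P

  data Lower (a b : Arc) : Set where
    marked : b ∈ keys → Lower a b
    ranked : rank b < rank a → Lower a b

  lower? : ∀ a b → Dec (Lower a b)
  lower? a b with b A.∈? keys | rank b <? rank a
  ... | yes b∈ | _      = yes (marked b∈)
  ... | no  _  | yes b< = yes (ranked b<)
  ... | no  b∉ | no  b≮ = no λ { (marked b∈) → b∉ b∈ ; (ranked b<) → b≮ b< }

  later : ∀ {a b} → b ∉ keys → rank a < rank b → ¬ Lower a b
  later b∉ _   (marked b∈) = b∉ b∈
  later _  a<b (ranked b<a) = <-asym a<b b<a

  lowerNbrs : Arc → List (Fin d)
  lowerNbrs a = filter (lower? a ∘ neighbour a) (allFin d)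

  ∈-lowerNbrs⁻ : ∀ {a j} → j ∈ lowerNbrs a → Lower a (neighbour a j)
  ∈-lowerNbrs⁻ {a} = proj₂ ∘ ∈-filter⁻ (lower? a ∘ neighbour a) {xs = allFin d}

  ∈-lowerNbrs⁺ : ∀ {a j} → Lower a (neighbour a j) → j ∈ lowerNbrs a
  ∈-lowerNbrs⁺ {a} {j} = ∈-filter⁺ (lower? a ∘ neighbour a) (∈-allFin j)

  lower-unmarked : ∀ {a b} → Lower a b → b ∉ keys → rank b < rank a
  lower-unmarked (marked b∈) b∉ = contradiction b∈ b∉
  lower-unmarked (ranked b<a) _ = b<a

  precolour : ∀ {a} → a ∈ keys → ℕ
  precolour a∈ = proj₂ (proj₁ (∈-map⁻ proj₁ a∈))

  -- The fuel only makes the recursion structural: any fuel above rank a gives the same colour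
  -- (colourWith-stable).
  opaque
    colourWith : ℕ → Arc → ℕ
    colourWith fuel a with a A.∈? keys
    ... | yes a∈ = precolour a∈
    colourWith zero       a | no _ = 0
    colourWith (suc fuel) a | no _ = firstFree (L a) (map (colourWith fuel ∘ neighbour a) (lowerNbrs a))

    σ : Arc → ℕ
    σ a = colourWith (suc (rank a)) a

    colourWith-stable : ∀ f f′ a → (a ∉ keys → rank a < f) → (a ∉ keys → rank a < f′) →
                        colourWith f a ≡ colourWith f′ a
    colourWith-stable f f′ a enough enough′ with a A.∈? keys
    ... | yes _ = refl
    colourWith-stable zero    f′       a enough enough′ | no a∉ = contradiction (enough a∉) λ ()
    colourWith-stable (suc f) zero     a enough enough′ | no a∉ = contradiction (enough′ a∉) λ ()
    colourWith-stable (suc f) (suc f′) a enough enough′ | no a∉ =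
      cong (firstFree (L a)) (map-cong-local (All.tabulate λ j∈ →
        colourWith-stable f f′ _ (below (enough a∉) j∈) (below (enough′ a∉) j∈)))
      where
      below : ∀ {g j} → rank a < suc g → j ∈ lowerNbrs a → neighbour a j ∉ keys → rank (neighbour a j) < g
      below a<g j∈ b∉ = <-≤-trans (lower-unmarked (∈-lowerNbrs⁻ j∈) b∉) (≤-pred a<g)

    σ-unmarked : ∀ {a} → a ∉ keys → σ a ≡ firstFree (L a) (map (σ ∘ neighbour a) (lowerNbrs a))
    σ-unmarked {a} a∉ with a A.∈? keys
    ... | yes a∈ = contradiction a∈ a∉
    ... | no  _  = cong (firstFree (L a)) (map-cong-local (All.tabulate λ j∈ →
          colourWith-stable _ _ _ (lower-unmarked (∈-lowerNbrs⁻ j∈)) (λ _ → n<1+n _)))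

    σ-marked : Unique keys → ∀ {a y} → (a , y) ∈ P → σ a ≡ y
    σ-marked uniq {a} ay∈ with a A.∈? keys
    ... | no  a∉ = contradiction (∈-map⁺ proj₁ ay∈) a∉
    ... | yes a∈ with ∈-map⁻ proj₁ a∈
    ...   | (_ , z) , az∈ , refl = keys-functional uniq az∈ ay∈

  Forbidden : Arc → List ℕ
  Forbidden a = map (σ ∘ neighbour a) (lowerNbrs a)

  record FreeColour (a : Arc) : Set where
    constructor free-colour
    field
      colour     : ℕ
      colour∈L   : colour ∈ L a
      colour∉Forb : colour ∉ Forbidden a

  Covers : Arc → List ℕ → Set
  Covers a F′ = ∀ j → Lower a (neighbour a j) → σ (neighbour a j) ∈ L a → σ (neighbour a j) ∈ F′

  free-if-covered : ∀ {a k} F′ → UniqueOfLength k (L a) → length F′ < k → Covers a F′ → FreeColour a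
  free-if-covered {a} F′ uL F′<k cover =
    let y , y∈L , y∉F = free-element F′ uL F′<k covered in free-colour y y∈L y∉F
    where
    covered : Forbidden a ⊆ F′ within L a
    covered y∈L y∈F with ∈-map⁻ (σ ∘ neighbour a) y∈F
    ... | j , j∈ , refl = cover j (∈-lowerNbrs⁻ j∈) y∈L

  free-if-two-later : ∀ {a k} j₁ j₂ → UniqueOfLength k (L a) → d ≤ suc k → j₁ ≢ j₂ →
                      ¬ Lower a (neighbour a j₁) → ¬ Lower a (neighbour a j₂) → FreeColour a
  free-if-two-later {a} {k} j₁ j₂ uL d≤1+k j₁≢j₂ later₁ later₂ =
    free-if-covered (map (σ ∘ neighbour a) rest) uL short cover
    where
    rest = (allFin d J.∖ (j₁ ∷ [])) J.∖ (j₂ ∷ [])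
    short : length (map (σ ∘ neighbour a) rest) < k
    short = subst (_< k) (sym (length-map (σ ∘ neighbour a) rest))
                  (≤-pred (≤-trans (s≤s rest<) (≤-trans without-j₁< d≤1+k)))
      where
      rest< : length rest < length (allFin d J.∖ (j₁ ∷ []))
      rest< = J.length-∖-< (J.∈-∖-singleton (∈-allFin j₂) (j₁≢j₂ ∘ sym))
      without-j₁< : length (allFin d J.∖ (j₁ ∷ [])) < d
      without-j₁< = subst (length (allFin d J.∖ (j₁ ∷ [])) <_) (length-tabulate id)
                          (J.length-∖-< (∈-allFin j₁))
    cover : Covers a (map (σ ∘ neighbour a) rest)
    cover j low _ = ∈-map⁺ (σ ∘ neighbour a)
      (J.∈-∖-singleton (J.∈-∖-singleton (∈-allFin j) λ { refl → later₁ low }) λ { refl → later₂ low })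

  Listed : Arc × ℕ → Set
  Listed (a , y) = y ∈ L a

  Compatible : Arc × ℕ → Arc × ℕ → Set
  Compatible (a , y) (b , z) = a ≢ b → Conflict a b → y ≢ z

  compatible-if-apart : ∀ {a b y z} → ¬ Conflict a b → Compatible (a , y) (b , z)
  compatible-if-apart apart _ conflict = ⊥-elim (apart conflict)

  compatible-if-distinct : ∀ {a b y z} → y ≢ z → Compatible (a , y) (b , z)
  compatible-if-distinct y≢z _ _ = y≢z

  module Proper (keys-unique : Unique keys) (precolours-listed : All Listed P)
                (precolours-compatible : AllPairs Compatible P)
                (free : ∀ a → a ∉ keys → FreeColour a) where

    σ-unmarked-free : ∀ {a} → a ∉ keys → σ a ∈ L a × σ a ∉ Forbidden a
    σ-unmarked-free {a} a∉ = subst (λ c → c ∈ L a × c ∉ Forbidden a) (sym (σ-unmarked a∉))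
                                   (firstFree-free (L a) (Forbidden a) (colour , colour∈L , colour∉Forb))
      where open FreeColour (free a a∉)

    σ-∈-L : ∀ a → σ a ∈ L a
    σ-∈-L a with a A.∈? keys
    ... | no  a∉ = proj₁ (σ-unmarked-free a∉)
    ... | yes a∈ with ∈-map⁻ proj₁ a∈
    ...   | (_ , y) , ay∈ , refl =
      subst (_∈ L a) (sym (σ-marked keys-unique ay∈)) (All.lookup precolours-listed ay∈)

    avoids-lower : ∀ {a b} → a ∉ keys → a ≢ b → Conflict a b → Lower a b → σ a ≢ σ b
    avoids-lower {a} a∉ a≢b conflict low σa≡σb with nbrs-complete a≢b conflict
    ... | j , refl = proj₂ (σ-unmarked-free a∉)
                           (subst (_∈ Forbidden a) (sym σa≡σb) (∈-map⁺ (σ ∘ neighbour a) (∈-lowerNbrs⁺ low)))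

    σ-proper : ∀ a b → a ≢ b → Conflict a b → σ a ≢ σ b
    σ-proper a b a≢b conflict with a A.∈? keys | b A.∈? keys
    ... | no  a∉ | yes b∈ = avoids-lower a∉ a≢b conflict (marked b∈)
    ... | yes a∈ | no  b∉ = avoids-lower b∉ (a≢b ∘ sym) (conflict-sym conflict) (marked a∈) ∘ sym
    ... | no  a∉ | no  b∉ with <-cmp (rank a) (rank b)
    ...   | tri< a<b _ _ = avoids-lower b∉ (a≢b ∘ sym) (conflict-sym conflict) (ranked a<b) ∘ sym
    ...   | tri≈ _ a≈b _ = contradiction (rank-injective a≈b) a≢b
    ...   | tri> _ _ b<a = avoids-lower a∉ a≢b conflict (ranked b<a)
    σ-proper a b a≢b conflict | yes a∈ | yes b∈ with ∈-map⁻ proj₁ a∈ | ∈-map⁻ proj₁ b∈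
    ... | (_ , y) , ay∈ , refl | (_ , z) , bz∈ , refl
      rewrite σ-marked keys-unique ay∈ | σ-marked keys-unique bz∈
      with allPairs-lookup precolours-compatible ay∈ bz∈
    ... | inj₁ refl        = contradiction refl a≢b
    ... | inj₂ (inj₁ a~b) = a~b a≢b conflict
    ... | inj₂ (inj₂ b~a) = b~a (a≢b ∘ sym) (conflict-sym conflict) ∘ sym

data Dir : Set where
  fwd bwd chd : Dir

offset : Dir → ℕ
offset chd = 0
offset fwd = 1
offset bwd = 2

offset<3 : ∀ d → offset d < 3
offset<3 chd = s≤s z≤n
offset<3 fwd = s≤s (s≤s z≤n)
offset<3 bwd = s≤s (s≤s (s≤s z≤n))

offset-injective : ∀ {d d′} → offset d ≡ offset d′ → d ≡ d′
offset-injective {chd} {chd} _ = refl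
offset-injective {fwd} {fwd} _ = refl
offset-injective {bwd} {bwd} _ = refl
offset-injective {chd} {fwd} ()
offset-injective {chd} {bwd} ()
offset-injective {fwd} {chd} ()
offset-injective {fwd} {bwd} ()
offset-injective {bwd} {chd} ()
offset-injective {bwd} {fwd} ()

_≟ᵈ_ : DecidableEquality Dir
d ≟ᵈ d′ with offset d ℕ.≟ offset d′
... | yes eq = yes (offset-injective eq)
... | no  ne = no λ { refl → ne refl }

*3+-injective : ∀ {a b x y} → x < 3 → y < 3 → a * 3 + x ≡ b * 3 + y → a ≡ b × x ≡ y
*3+-injective {zero}  {zero}  _ _ eq = refl , eq
*3+-injective {suc a} {suc b} x<3 y<3 eq
  with *3+-injective {a} {b} x<3 y<3 (suc-injective (suc-injective (suc-injective eq)))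
... | refl , x≡y = refl , x≡y
*3+-injective {zero}  {suc b} (s≤s (s≤s (s≤s ()))) _ refl
*3+-injective {suc a} {zero}  _ (s≤s (s≤s (s≤s ()))) refl

*3+-mono : ∀ {a b x y} → a < b → x < 3 → a * 3 + x < b * 3 + y
*3+-mono {zero}  {suc b} {y = y} _ x<3 = ≤-trans x<3 (m≤m+n 3 (b * 3 + y))
*3+-mono {suc a} {suc b} (s≤s a<b) x<3 = s≤s (s≤s (s≤s (*3+-mono a<b x<3)))

module ChordedCycle (N : ℕ) (chord : Fin (4 + N) → Fin (4 + N))
  (chord-involutive : ∀ i → chord (chord i) ≡ i)
  (chord≢next : ∀ i → chord i ≢ next i) (chord≢prev : ∀ i → chord i ≢ prev i)
  (chord≢self : ∀ i → chord i ≢ i) where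

  Pos : Set
  Pos = Fin (4 + N)

  Arc : Set
  Arc = Pos × Dir

  _≟ᵃ_ : DecidableEquality Arc
  _≟ᵃ_ = ≡-dec _≟ᶠ_ _≟ᵈ_

  arc≢ : ∀ {i j : Pos} {d d′ : Dir} → i ≢ j → (i , d) ≢ (j , d′)
  arc≢ i≢j refl = i≢j refl

  tgt : Arc → Pos
  tgt (i , fwd) = next i
  tgt (i , bwd) = prev i
  tgt (i , chd) = chord i

  data Conflict (a b : Arc) : Set where
    same-src : proj₁ a ≡ proj₁ b → Conflict a b
    tgt-src  : tgt a ≡ proj₁ b → Conflict a b
    src-tgt  : tgt b ≡ proj₁ a → Conflict a b

  conflict-sym : ∀ {a b} → Conflict a b → Conflict b a
  conflict-sym (same-src eq) = same-src (sym eq)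
  conflict-sym (tgt-src eq)  = src-tgt eq
  conflict-sym (src-tgt eq)  = tgt-src eq

  nbrs : Arc → Vec Arc 7
  nbrs (i , fwd) = (i , bwd) ∷ (i , chd) ∷ (next i , fwd) ∷ (next i , bwd) ∷ (next i , chd)
                 ∷ (prev i , fwd) ∷ (chord i , chd) ∷ []
  nbrs (i , bwd) = (i , fwd) ∷ (i , chd) ∷ (prev i , fwd) ∷ (prev i , bwd) ∷ (prev i , chd)
                 ∷ (next i , bwd) ∷ (chord i , chd) ∷ []
  nbrs (i , chd) = (i , fwd) ∷ (i , bwd) ∷ (chord i , fwd) ∷ (chord i , bwd) ∷ (chord i , chd)
                 ∷ (prev i , fwd) ∷ (next i , bwd) ∷ []

  chord-injective : ∀ {i j} → chord i ≡ chord j → i ≡ j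
  chord-injective {i} {j} eq = trans (sym (chord-involutive i)) (trans (cong chord eq) (chord-involutive j))

  arcs-into : ∀ {j i} d → tgt (j , d) ≡ i →
              (j , d) ≡ (prev i , fwd) ⊎ (j , d) ≡ (next i , bwd) ⊎ (j , d) ≡ (chord i , chd)
  arcs-into {j} fwd refl = inj₁ (cong (_, fwd) (sym (prev-next j)))
  arcs-into {j} bwd refl = inj₂ (inj₁ (cong (_, bwd) (sym (next-prev j))))
  arcs-into {j} chd refl = inj₂ (inj₂ (cong (_, chd) (sym (chord-involutive j))))

  nbr-same-src : ∀ {i} d d′ → d ≢ d′ → ∃ λ j → lookup (nbrs (i , d)) j ≡ (i , d′)
  nbr-same-src fwd fwd d≢d′ = contradiction refl d≢d′
  nbr-same-src fwd bwd _    = # 0 , refl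
  nbr-same-src fwd chd _    = # 1 , refl
  nbr-same-src bwd fwd _    = # 0 , refl
  nbr-same-src bwd bwd d≢d′ = contradiction refl d≢d′
  nbr-same-src bwd chd _    = # 1 , refl
  nbr-same-src chd fwd _    = # 0 , refl
  nbr-same-src chd bwd _    = # 1 , refl
  nbr-same-src chd chd d≢d′ = contradiction refl d≢d′

  nbr-from-tgt : ∀ a d′ → ∃ λ j → lookup (nbrs a) j ≡ (tgt a , d′)
  nbr-from-tgt (_ , fwd) fwd = # 2 , refl
  nbr-from-tgt (_ , fwd) bwd = # 3 , refl
  nbr-from-tgt (_ , fwd) chd = # 4 , refl
  nbr-from-tgt (_ , bwd) fwd = # 2 , refl
  nbr-from-tgt (_ , bwd) bwd = # 3 , refl
  nbr-from-tgt (_ , bwd) chd = # 4 , refl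
  nbr-from-tgt (_ , chd) fwd = # 2 , refl
  nbr-from-tgt (_ , chd) bwd = # 3 , refl
  nbr-from-tgt (_ , chd) chd = # 4 , refl

  nbr-into-src : ∀ i d b → tgt b ≡ i → ∃ λ j → lookup (nbrs (i , d)) j ≡ b
  nbr-into-src i d (j , d′) e with arcs-into d′ e
  nbr-into-src i fwd _ _ | inj₁ refl        = # 5 , refl
  nbr-into-src i bwd _ _ | inj₁ refl        = # 2 , refl
  nbr-into-src i chd _ _ | inj₁ refl        = # 5 , refl
  nbr-into-src i fwd _ _ | inj₂ (inj₁ refl) = # 3 , refl
  nbr-into-src i bwd _ _ | inj₂ (inj₁ refl) = # 5 , refl
  nbr-into-src i chd _ _ | inj₂ (inj₁ refl) = # 6 , refl
  nbr-into-src i fwd _ _ | inj₂ (inj₂ refl) = # 6 , refl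
  nbr-into-src i bwd _ _ | inj₂ (inj₂ refl) = # 6 , refl
  nbr-into-src i chd _ _ | inj₂ (inj₂ refl) = # 4 , refl

  nbrs-complete : ∀ {a b} → a ≢ b → Conflict a b → ∃ λ j → lookup (nbrs a) j ≡ b
  nbrs-complete {i , d} {.i , d′} a≢b (same-src refl) = nbr-same-src d d′ λ { refl → a≢b refl }
  nbrs-complete {a} {.(tgt a) , d′} _ (tgt-src refl)    = nbr-from-tgt a d′
  nbrs-complete {i , d} {b} _ (src-tgt e)               = nbr-into-src i d b e

  one two : Pos
  one = suc zero
  two = suc (suc zero)

  -- Vertex n−1 is coloured first and vertex 0 last.
  rank : Arc → ℕ
  rank (i , d) = key i * 3 + offset d

  rank-injective : ∀ {a b} → rank a ≡ rank b → a ≡ b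
  rank-injective {i , d} {j , d′} eq with *3+-injective (offset<3 d) (offset<3 d′) eq
  ... | key≡ , offset≡ = cong₂ _,_ (key-injective key≡) (offset-injective offset≡)

  rank-chd<fwd : ∀ i → rank (i , chd) < rank (i , fwd)
  rank-chd<fwd i = +-monoʳ-< (key i * 3) (s≤s z≤n)

  rank-chd<bwd : ∀ i → rank (i , chd) < rank (i , bwd)
  rank-chd<bwd i = +-monoʳ-< (key i * 3) (s≤s z≤n)

  rank-fwd<bwd : ∀ i → rank (i , fwd) < rank (i , bwd)
  rank-fwd<bwd i = +-monoʳ-< (key i * 3) (s≤s (s≤s z≤n))

  rank-<-key : ∀ {i j} d d′ → key i < key j → rank (i , d) < rank (j , d′)
  rank-<-key d _ i<j = *3+-mono i<j (offset<3 d)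

  rank-<-prev : ∀ {i} → i ≢ zero → ∀ d d′ → rank (i , d) < rank (prev i , d′)
  rank-<-prev {i} i≢0 d d′ = rank-<-key {i} {prev i} d d′ (key-<-prev i≢0)

  rank-<-zero : ∀ {i} → i ≢ zero → ∀ d d′ → rank (i , d) < rank (zero , d′)
  rank-<-zero {i} i≢0 d d′ = rank-<-key {i} {zero} d d′ (key-<-zero i≢0)

  rank-<-one : ∀ {i} → i ≢ zero → i ≢ one → ∀ d d′ → rank (i , d) < rank (one , d′)
  rank-<-one {i} i≢0 i≢1 d d′ = rank-<-key {i} {one} d d′ (key-<-one i≢0 i≢1)

  module Colouring (L : Arc → List ℕ) (L-size : ∀ a → UniqueOfLength 6 (L a)) where

    T₁ T₂ T₃ : Arc
    T₁ = one , bwd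
    T₂ = prev zero , fwd
    T₃ = chord zero , chd

    -- Opaque, so that goals mentioning the chosen colours do not normalise through the choice.
    opaque
      three : ThreeChoice (L (zero , bwd)) (L (zero , fwd)) (L T₁) (L T₂) (L T₃)
      three = choose-three (L-size _) (L-size _) (L-size _) (L-size _) (L-size _)

    open ThreeChoice three

    into-zero-no-conflict : ∀ {a b} → tgt a ≡ zero → tgt b ≡ zero → proj₁ a ≢ zero → proj₁ b ≢ zero →
                            proj₁ a ≢ proj₁ b → ¬ Conflict a b
    into-zero-no-conflict _   _   _   _   a≢b (same-src a≡b) = a≢b a≡b
    into-zero-no-conflict ta0 _   _   b≢0 _   (tgt-src ta≡b) = b≢0 (trans (sym ta≡b) ta0)
    into-zero-no-conflict _   tb0 a≢0 _   _   (src-tgt tb≡a) = a≢0 (trans (sym tb≡a) tb0)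

    tgt-T₂ : tgt T₂ ≡ zero
    tgt-T₂ = next-prev zero

    tgt-T₃ : tgt T₃ ≡ zero
    tgt-T₃ = chord-involutive zero

    one≢chord-zero : one ≢ chord zero
    one≢chord-zero = chord≢next zero ∘ sym

    prev-zero≢chord-zero : prev zero ≢ chord zero
    prev-zero≢chord-zero = chord≢prev zero ∘ sym

    T₁-T₂ : ¬ Conflict T₁ T₂
    T₁-T₂ = into-zero-no-conflict refl tgt-T₂ (λ ()) (λ ()) (λ ())

    T₁-T₃ : ¬ Conflict T₁ T₃
    T₁-T₃ = into-zero-no-conflict refl tgt-T₃ (λ ()) (chord≢self zero) one≢chord-zero

    T₂-T₃ : ¬ Conflict T₂ T₃
    T₂-T₃ = into-zero-no-conflict tgt-T₂ tgt-T₃ (λ ()) (chord≢self zero) prev-zero≢chord-zero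

    module Precoloured (Pp Pq : Arc) (yp yq : ℕ) (keys-unique : Unique (T₁ ∷ T₂ ∷ T₃ ∷ Pp ∷ Pq ∷ [])) where

      open Greedy _≟ᵃ_ Conflict conflict-sym nbrs nbrs-complete rank rank-injective L
                  ((T₁ , y₁) ∷ (T₂ , y₂) ∷ (T₃ , y₃) ∷ (Pp , yp) ∷ (Pq , yq) ∷ []) public

      unmarked : ∀ {b} → b ≢ T₁ → b ≢ T₂ → b ≢ T₃ → b ≢ Pp → b ≢ Pq → b ∉ keys
      unmarked ≢₁ _  _  _  _  (here eq)                                 = ≢₁ eq
      unmarked _  ≢₂ _  _  _  (there (here eq))                         = ≢₂ eq
      unmarked _  _  ≢₃ _  _  (there (there (here eq)))                 = ≢₃ eq
      unmarked _  _  _  ≢p _  (there (there (there (here eq))))         = ≢p eq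
      unmarked _  _  _  _  ≢q (there (there (there (there (here eq))))) = ≢q eq

      σ-T₁ : σ T₁ ≡ y₁
      σ-T₁ = σ-marked keys-unique (here refl)

      σ-T₂ : σ T₂ ≡ y₂
      σ-T₂ = σ-marked keys-unique (there (here refl))

      σ-T₃ : σ T₃ ≡ y₃
      σ-T₃ = σ-marked keys-unique (there (there (here refl)))

      free-zero-fwd : (zero , bwd) ∉ keys → FreeColour (zero , fwd)
      free-zero-fwd zero-bwd∉ = free-if-covered F′ (L-size _) (n<1+n 5) cover
        where
        F′ : List ℕ
        F′ = σ (zero , chd) ∷ σ (one , fwd) ∷ σ (one , chd) ∷ t₁ ∷ t₂ ∷ []
        precoloured : ∀ {a y} → σ a ≡ y → y ∈ y₁ ∷ y₂ ∷ y₃ ∷ [] → σ a ∈ L (zero , fwd) → σ a ∈ F′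
        precoloured refl y∈ y∈L = there (there (there (two-in-T y∈L y∈)))
        cover : Covers (zero , fwd) F′
        cover zero low _ = contradiction low (later zero-bwd∉ (rank-fwd<bwd zero))
        cover (suc zero) _ _ = here refl
        cover (suc (suc zero)) _ _ = there (here refl)
        cover (suc (suc (suc zero))) _ = precoloured σ-T₁ (here refl)
        cover (suc (suc (suc (suc zero)))) _ _ = there (there (here refl))
        cover (suc (suc (suc (suc (suc zero))))) _ = precoloured σ-T₂ (there (here refl))
        cover (suc (suc (suc (suc (suc (suc zero)))))) _ = precoloured σ-T₃ (there (there (here refl)))

      free-zero-bwd : FreeColour (zero , bwd)
      free-zero-bwd = free-if-covered F′ (L-size _) (n<1+n 5) cover
        where
        F′ : List ℕ
        F′ = σ (zero , fwd) ∷ σ (zero , chd) ∷ σ (prev zero , bwd) ∷ σ (prev zero , chd) ∷ s ∷ []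
        precoloured : ∀ {a y} → σ a ≡ y → y ∈ y₁ ∷ y₂ ∷ y₃ ∷ [] → σ a ∈ L (zero , bwd) → σ a ∈ F′
        precoloured refl y∈ y∈L = there (there (there (there (one-in-S y∈L y∈))))
        cover : Covers (zero , bwd) F′
        cover zero _ _ = here refl
        cover (suc zero) _ _ = there (here refl)
        cover (suc (suc zero)) _ = precoloured σ-T₂ (there (here refl))
        cover (suc (suc (suc zero))) _ _ = there (there (here refl))
        cover (suc (suc (suc (suc zero)))) _ _ = there (there (there (here refl)))
        cover (suc (suc (suc (suc (suc zero))))) _ = precoloured σ-T₁ (here refl)
        cover (suc (suc (suc (suc (suc (suc zero)))))) _ = precoloured σ-T₃ (there (there (here refl)))

    -- X = (1 , fwd) loses the uncoloured neighbour T₁; Dp and Dq collect the colours of the arcs into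
    -- 0 that may conflict with Pp and Pq.
    module ChordAvoidsTwo (chord-zero≢two : chord zero ≢ two) where

      X Pp Pq : Arc
      X  = one , fwd
      Pp = two , chd
      Pq = chord one , chd

      opaque
        pair : PairChoice (L X) (L Pp) (L Pq) (y₂ ∷ y₃ ∷ []) (y₁ ∷ y₂ ∷ y₃ ∷ [])
        pair = choose-pair (L-size _) (L-size _) (L-size _) (n<1+n 5)

      open PairChoice pair

      keys-unique : Unique (T₁ ∷ T₂ ∷ T₃ ∷ Pp ∷ Pq ∷ [])
      keys-unique = ((λ ()) ∷ (λ ()) ∷ (λ ()) ∷ (λ ()) ∷ [])
                  ∷ ((λ ()) ∷ (λ ()) ∷ (λ ()) ∷ [])
                  ∷ (arc≢ chord-zero≢two ∷ arc≢ (λ eq → zero≢one (chord-injective eq)) ∷ [])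
                  ∷ (arc≢ (chord≢next one ∘ sym) ∷ [])
                  ∷ [] ∷ []
        where
        zero≢one : zero ≢ one
        zero≢one ()

      open Precoloured Pp Pq yp yq keys-unique public

      Pp-T₁ : ¬ Conflict Pp T₁
      Pp-T₁ (tgt-src chord-two≡one) = chord≢prev two chord-two≡one
      
      Pp-Pq : ¬ Conflict Pp Pq
      Pp-Pq (same-src two≡chord-one) = chord≢next one (sym two≡chord-one)
      Pp-Pq (tgt-src eq) with chord-injective eq
      ... | ()
      Pp-Pq (src-tgt eq) with trans (sym (chord-involutive one)) eq
      ... | ()

      listed : All Listed ((T₁ , y₁) ∷ (T₂ , y₂) ∷ (T₃ , y₃) ∷ (Pp , yp) ∷ (Pq , yq) ∷ [])
      listed = y₁∈X₁ ∷ y₂∈X₂ ∷ y₃∈X₃ ∷ yp∈Lp ∷ yq∈Lq ∷ []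

      compatible : AllPairs Compatible ((T₁ , y₁) ∷ (T₂ , y₂) ∷ (T₃ , y₃) ∷ (Pp , yp) ∷ (Pq , yq) ∷ [])
      compatible = ( compatible-if-apart T₁-T₂ ∷ compatible-if-apart T₁-T₃ ∷ compatible-if-apart (Pp-T₁ ∘ conflict-sym)
                     ∷ compatible-if-distinct (yq∉Dq ∘ here ∘ sym) ∷ [])
                 ∷ ( compatible-if-apart T₂-T₃ ∷ compatible-if-distinct (yp∉Dp ∘ here ∘ sym)
                     ∷ compatible-if-distinct (yq∉Dq ∘ there ∘ here ∘ sym) ∷ [])
                 ∷ ( compatible-if-distinct (yp∉Dp ∘ there ∘ here ∘ sym)
                     ∷ compatible-if-distinct (yq∉Dq ∘ there ∘ there ∘ here ∘ sym) ∷ [])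
                 ∷ (compatible-if-apart Pp-Pq ∷ [])
                 ∷ [] ∷ []

      unmarked-fwd : ∀ {i} → i ≢ prev zero → (i , fwd) ∉ keys
      unmarked-fwd i≢ = unmarked (λ ()) (arc≢ i≢) (λ ()) (λ ()) (λ ())

      unmarked-bwd : ∀ {i} → i ≢ one → (i , bwd) ∉ keys
      unmarked-bwd i≢ = unmarked (arc≢ i≢) (λ ()) (λ ()) (λ ()) (λ ())

      unmarked-chd : ∀ {i} → i ≢ chord zero → i ≢ two → i ≢ chord one → (i , chd) ∉ keys
      unmarked-chd ≢₃ ≢p ≢q = unmarked (λ ()) (λ ()) (arc≢ ≢₃) (arc≢ ≢p) (arc≢ ≢q)

      σ-Pp : σ Pp ≡ yp
      σ-Pp = σ-marked keys-unique (there (there (there (here refl))))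

      σ-Pq : σ Pq ≡ yq
      σ-Pq = σ-marked keys-unique (there (there (there (there (here refl)))))

      free-X : FreeColour X
      free-X = free-if-covered F′ (L-size _) (n<1+n 5) cover
        where
        F′ : List ℕ
        F′ = σ (one , bwd) ∷ σ (one , chd) ∷ σ (two , fwd) ∷ σ (two , bwd) ∷ r ∷ []
        precoloured : ∀ {a y} → σ a ≡ y → y ∈ yp ∷ yq ∷ [] → σ a ∈ L X → σ a ∈ F′
        precoloured refl y∈ y∈L = there (there (there (there (one-in-X y∈L y∈))))
        cover : Covers X F′
        cover zero _ _ = here refl
        cover (suc zero) _ _ = there (here refl)
        cover (suc (suc zero)) _ _ = there (there (here refl))
        cover (suc (suc (suc zero))) _ _ = there (there (there (here refl)))
        cover (suc (suc (suc (suc zero)))) _ = precoloured σ-Pp (here refl)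
        cover (suc (suc (suc (suc (suc zero))))) low _ =
          contradiction low (later (unmarked-fwd (λ ())) (rank-<-zero {one} (λ ()) fwd fwd))
        cover (suc (suc (suc (suc (suc (suc zero)))))) _ = precoloured σ-Pq (there (here refl))

      free-fwd : ∀ {i} → i ≢ zero → i ≢ one → FreeColour (i , fwd)
      free-fwd {i} i≢0 i≢1 = free-if-two-later (# 0) (# 5) (L-size _) ≤-refl (λ ())
        (later (unmarked-bwd i≢1) (rank-fwd<bwd i))
        (later (unmarked-fwd (i≢0 ∘ prev-injective)) (rank-<-prev i≢0 fwd fwd))

      free-two-bwd : FreeColour (two , bwd)
      free-two-bwd = free-if-two-later (# 2) (# 4) (L-size _) ≤-refl (λ ())
        (later (unmarked-fwd (λ ())) (rank-<-prev {two} (λ ()) bwd fwd))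
        (later (unmarked-chd one≢chord-zero (λ ()) (chord≢self one ∘ sym)) (rank-<-prev {two} (λ ()) bwd chd))

      free-bwd : ∀ {i} → i ≢ zero → i ≢ two → FreeColour (i , bwd)
      free-bwd {i} i≢0 i≢2 = free-if-two-later (# 2) (# 3) (L-size _) ≤-refl (λ ())
        (later (unmarked-fwd (i≢0 ∘ prev-injective)) (rank-<-prev i≢0 bwd fwd))
        (later (unmarked-bwd (i≢2 ∘ prev-injective)) (rank-<-prev i≢0 bwd bwd))

      free-zero-chd : FreeColour (zero , chd)
      free-zero-chd = free-if-two-later (# 0) (# 1) (L-size _) ≤-refl (λ ())
        (later (unmarked-fwd (λ ())) (rank-chd<fwd zero))
        (later (unmarked-bwd (λ ())) (rank-chd<bwd zero))

      free-one-chd : FreeColour (one , chd)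
      free-one-chd = free-if-two-later (# 0) (# 5) (L-size _) ≤-refl (λ ())
        (later (unmarked-fwd (λ ())) (rank-chd<fwd one))
        (later (unmarked-fwd (λ ())) (rank-<-zero {one} (λ ()) chd fwd))

      free-chd : ∀ {i} → i ≢ zero → i ≢ one → FreeColour (i , chd)
      free-chd {i} i≢0 i≢1 = free-if-two-later (# 1) (# 5) (L-size _) ≤-refl (λ ())
        (later (unmarked-bwd i≢1) (rank-chd<bwd i))
        (later (unmarked-fwd (i≢0 ∘ prev-injective)) (rank-<-prev i≢0 chd fwd))

      free : ∀ a → a ∉ keys → FreeColour a
      free (i , fwd) _ with i ≟ᶠ zero | i ≟ᶠ one
      ... | yes refl | _         = free-zero-fwd (unmarked-bwd (λ ()))
      ... | no _    | yes refl = free-X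
      ... | no i≢0  | no i≢1  = free-fwd i≢0 i≢1
      free (i , bwd) _ with i ≟ᶠ zero | i ≟ᶠ two
      ... | yes refl | _         = free-zero-bwd
      ... | no _    | yes refl = free-two-bwd
      ... | no i≢0  | no i≢2  = free-bwd i≢0 i≢2
      free (i , chd) _ with i ≟ᶠ zero | i ≟ᶠ one
      ... | yes refl | _         = free-zero-chd
      ... | no _    | yes refl = free-one-chd
      ... | no i≢0  | no i≢1  = free-chd i≢0 i≢1

      open Proper keys-unique listed compatible free public

    -- Here T₃ = (2 , chd) would clash with the choice above. Instead Pp = (1 , fwd) is itself
    -- precoloured, leaving X = (1 , chd) with the single uncoloured neighbour (0 , fwd).
    module ChordToTwo (chord-zero≡two : chord zero ≡ two) where

      X Pp Pq : Arc
      X  = one , chd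
      Pp = one , fwd
      Pq = chord one , bwd

      opaque
        pair : PairChoice (L X) (L Pp) (L Pq) (y₁ ∷ y₃ ∷ []) (y₁ ∷ y₂ ∷ y₃ ∷ [])
        pair = choose-pair (L-size _) (L-size _) (L-size _) (n<1+n 5)

      open PairChoice pair

      chord-one≢zero : chord one ≢ zero
      chord-one≢zero = chord≢prev one

      chord-one≢one : chord one ≢ one
      chord-one≢one = chord≢self one

      chord-one≢two : chord one ≢ two
      chord-one≢two = chord≢next one

      two≢zero : two ≢ zero
      two≢zero ()

      chord-two≡zero : chord two ≡ zero
      chord-two≡zero = trans (cong chord (sym chord-zero≡two)) (chord-involutive zero)

      keys-unique : Unique (T₁ ∷ T₂ ∷ T₃ ∷ Pp ∷ Pq ∷ [])
      keys-unique = ((λ ()) ∷ (λ ()) ∷ (λ ()) ∷ arc≢ (chord-one≢one ∘ sym) ∷ [])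
                  ∷ ((λ ()) ∷ (λ ()) ∷ (λ ()) ∷ [])
                  ∷ ((λ ()) ∷ (λ ()) ∷ [])
                  ∷ ((λ ()) ∷ [])
                  ∷ [] ∷ []

      open Precoloured Pp Pq yp yq keys-unique public

      Pp-T₂ : ¬ Conflict Pp T₂
      Pp-T₂ (src-tgt eq) with trans (sym (next-prev zero)) eq
      ... | ()

      Pp-Pq : ¬ Conflict Pp Pq
      Pp-Pq (same-src eq) = chord-one≢one (sym eq)
      Pp-Pq (tgt-src eq)  = chord-one≢two (sym eq)
      Pp-Pq (src-tgt eq)  = chord≢next one (trans (sym (next-prev (chord one))) (cong next eq))

      listed : All Listed ((T₁ , y₁) ∷ (T₂ , y₂) ∷ (T₃ , y₃) ∷ (Pp , yp) ∷ (Pq , yq) ∷ [])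
      listed = y₁∈X₁ ∷ y₂∈X₂ ∷ y₃∈X₃ ∷ yp∈Lp ∷ yq∈Lq ∷ []

      compatible : AllPairs Compatible ((T₁ , y₁) ∷ (T₂ , y₂) ∷ (T₃ , y₃) ∷ (Pp , yp) ∷ (Pq , yq) ∷ [])
      compatible = ( compatible-if-apart T₁-T₂ ∷ compatible-if-apart T₁-T₃ ∷ compatible-if-distinct (yp∉Dp ∘ here ∘ sym)
                     ∷ compatible-if-distinct (yq∉Dq ∘ here ∘ sym) ∷ [])
                 ∷ ( compatible-if-apart T₂-T₃ ∷ compatible-if-apart (Pp-T₂ ∘ conflict-sym)
                     ∷ compatible-if-distinct (yq∉Dq ∘ there ∘ here ∘ sym) ∷ [])
                 ∷ ( compatible-if-distinct (yp∉Dp ∘ there ∘ here ∘ sym)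
                     ∷ compatible-if-distinct (yq∉Dq ∘ there ∘ there ∘ here ∘ sym) ∷ [])
                 ∷ (compatible-if-apart Pp-Pq ∷ [])
                 ∷ [] ∷ []

      unmarked-fwd : ∀ {i} → i ≢ prev zero → i ≢ one → (i , fwd) ∉ keys
      unmarked-fwd ≢₂ ≢p = unmarked (λ ()) (arc≢ ≢₂) (λ ()) (arc≢ ≢p) (λ ())

      unmarked-bwd : ∀ {i} → i ≢ one → i ≢ chord one → (i , bwd) ∉ keys
      unmarked-bwd ≢₁ ≢q = unmarked (arc≢ ≢₁) (λ ()) (λ ()) (λ ()) (arc≢ ≢q)

      unmarked-chd : ∀ {i} → i ≢ chord zero → (i , chd) ∉ keys
      unmarked-chd ≢₃ = unmarked (λ ()) (λ ()) (arc≢ ≢₃) (λ ()) (λ ())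

      σ-Pp : σ Pp ≡ yp
      σ-Pp = σ-marked keys-unique (there (there (there (here refl))))

      σ-Pq : σ Pq ≡ yq
      σ-Pq = σ-marked keys-unique (there (there (there (there (here refl)))))

      rank-<-chord-two : ∀ d d′ → rank (two , d) < rank (chord two , d′)
      rank-<-chord-two d d′ = subst (λ p → rank (two , d) < rank (p , d′)) (sym chord-two≡zero)
                                    (rank-<-zero {two} (λ ()) d d′)

      free-X : FreeColour X
      free-X = free-if-covered F′ (L-size _) (n<1+n 5) cover
        where
        F′ : List ℕ
        F′ = σ (one , bwd) ∷ σ (chord one , fwd) ∷ σ (chord one , chd) ∷ σ (two , bwd) ∷ r ∷ []
        precoloured : ∀ {a y} → σ a ≡ y → y ∈ yp ∷ yq ∷ [] → σ a ∈ L X → σ a ∈ F′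
        precoloured refl y∈ y∈L = there (there (there (there (one-in-X y∈L y∈))))
        cover : Covers X F′
        cover zero _ = precoloured σ-Pp (here refl)
        cover (suc zero) _ _ = here refl
        cover (suc (suc zero)) _ _ = there (here refl)
        cover (suc (suc (suc zero))) _ = precoloured σ-Pq (there (here refl))
        cover (suc (suc (suc (suc zero)))) _ _ = there (there (here refl))
        cover (suc (suc (suc (suc (suc zero))))) low _ =
          contradiction low (later (unmarked-fwd (λ ()) (λ ())) (rank-<-zero {one} (λ ()) chd fwd))
        cover (suc (suc (suc (suc (suc (suc zero)))))) _ _ = there (there (there (here refl)))

      free-fwd : ∀ {i} → i ≢ zero → i ≢ one → i ≢ two → i ≢ chord one → FreeColour (i , fwd)
      free-fwd {i} i≢0 i≢1 i≢2 i≢m1 = free-if-two-later (# 0) (# 5) (L-size _) ≤-refl (λ ())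
        (later (unmarked-bwd i≢1 i≢m1) (rank-fwd<bwd i))
        (later (unmarked-fwd (i≢0 ∘ prev-injective) (i≢2 ∘ prev-injective)) (rank-<-prev i≢0 fwd fwd))

      free-two-fwd : FreeColour (two , fwd)
      free-two-fwd = free-if-two-later (# 0) (# 6) (L-size _) ≤-refl (λ ())
        (later (unmarked-bwd (λ ()) (chord-one≢two ∘ sym)) (rank-fwd<bwd two))
        (later (unmarked-chd (λ eq → two≢zero (chord-injective eq))) (rank-<-chord-two fwd chd))

      free-chord-one-fwd : FreeColour (chord one , fwd)
      free-chord-one-fwd = free-if-two-later (# 5) (# 6) (L-size _) ≤-refl (λ ())
        (later (unmarked-fwd (chord-one≢zero ∘ prev-injective) (chord-one≢two ∘ prev-injective))
               (rank-<-prev chord-one≢zero fwd fwd))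
        (later (unmarked-chd (chord-one≢zero ∘ chord-injective))
               (subst (λ p → rank (chord one , fwd) < rank (p , chd)) (sym (chord-involutive one))
                      (rank-<-one chord-one≢zero chord-one≢one fwd chd)))

      free-two-bwd : FreeColour (two , bwd)
      free-two-bwd = free-if-two-later (# 4) (# 6) (L-size _) ≤-refl (λ ())
        (later (unmarked-chd one≢chord-zero) (rank-<-prev {two} (λ ()) bwd chd))
        (later (unmarked-chd (λ eq → two≢zero (chord-injective eq))) (rank-<-chord-two bwd chd))

      free-bwd-after-chord-one : ∀ {i} → i ≢ zero → prev i ≡ chord one → FreeColour (i , bwd)
      free-bwd-after-chord-one {i} i≢0 prev≡ = free-if-two-later (# 2) (# 4) (L-size _) ≤-refl (λ ())
        (later (unmarked-fwd (i≢0 ∘ prev-injective) (λ eq → chord-one≢one (trans (sym prev≡) eq)))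
               (rank-<-prev i≢0 bwd fwd))
        (later (unmarked-chd (λ eq → one≢zero (chord-injective (trans (sym prev≡) eq))))
               (rank-<-prev i≢0 bwd chd))
        where
        one≢zero : one ≢ zero
        one≢zero ()

      free-bwd : ∀ {i} → i ≢ zero → i ≢ two → prev i ≢ chord one → FreeColour (i , bwd)
      free-bwd {i} i≢0 i≢2 prev≢ = free-if-two-later (# 2) (# 3) (L-size _) ≤-refl (λ ())
        (later (unmarked-fwd (i≢0 ∘ prev-injective) (i≢2 ∘ prev-injective)) (rank-<-prev i≢0 bwd fwd))
        (later (unmarked-bwd (i≢2 ∘ prev-injective) prev≢) (rank-<-prev i≢0 bwd bwd))

      free-zero-chd : FreeColour (zero , chd)
      free-zero-chd = free-if-two-later (# 0) (# 1) (L-size _) ≤-refl (λ ())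
        (later (unmarked-fwd (λ ()) (λ ())) (rank-chd<fwd zero))
        (later (unmarked-bwd (λ ()) (chord-one≢zero ∘ sym)) (rank-chd<bwd zero))

      free-last-chd : FreeColour (prev zero , chd)
      free-last-chd = free-if-two-later (# 5) (# 6) (L-size _) ≤-refl (λ ())
        (later (unmarked-fwd (λ eq → last≢zero (prev-injective eq)) (λ eq → last≢two (prev-injective eq)))
               (rank-<-prev last≢zero chd fwd))
        (later (subst (λ p → (p , bwd) ∉ keys) (sym (next-prev zero)) (unmarked-bwd (λ ()) (chord-one≢zero ∘ sym)))
               (subst (λ p → rank (prev zero , chd) < rank (p , bwd)) (sym (next-prev zero))
                      (rank-<-zero last≢zero chd bwd)))
        where
        last≢zero : prev zero ≢ zero
        last≢zero ()
        last≢two : prev zero ≢ two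
        last≢two ()

      free-chord-one-chd : chord one ≢ prev zero → FreeColour (chord one , chd)
      free-chord-one-chd m1≢last = free-if-two-later (# 0) (# 5) (L-size _) ≤-refl (λ ())
        (later (unmarked-fwd m1≢last chord-one≢one) (rank-chd<fwd (chord one)))
        (later (unmarked-fwd (chord-one≢zero ∘ prev-injective) (chord-one≢two ∘ prev-injective))
               (rank-<-prev chord-one≢zero chd fwd))

      free-chd : ∀ {i} → i ≢ zero → i ≢ one → i ≢ chord zero → i ≢ chord one → FreeColour (i , chd)
      free-chd {i} i≢0 i≢1 i≢m0 i≢m1 = free-if-two-later (# 1) (# 5) (L-size _) ≤-refl (λ ())
        (later (unmarked-bwd i≢1 i≢m1) (rank-chd<bwd i))
        (later (unmarked-fwd (i≢0 ∘ prev-injective)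
                             (λ eq → i≢m0 (trans (prev-injective eq) (sym chord-zero≡two))))
               (rank-<-prev i≢0 chd fwd))

      free : ∀ a → a ∉ keys → FreeColour a
      free (i , fwd) a∉ with i ≟ᶠ zero | i ≟ᶠ one | i ≟ᶠ two | i ≟ᶠ chord one
      ... | yes refl | _         | _         | _         = free-zero-fwd (unmarked-bwd (λ ()) (chord-one≢zero ∘ sym))
      ... | no _    | yes refl | _         | _         = ⊥-elim (a∉ (there (there (there (here refl)))))
      ... | no _    | no _    | yes refl | _         = free-two-fwd
      ... | no _    | no _    | no _    | yes refl = free-chord-one-fwd
      ... | no i≢0  | no i≢1  | no i≢2  | no i≢m1 = free-fwd i≢0 i≢1 i≢2 i≢m1
      free (i , bwd) a∉ with i ≟ᶠ zero | i ≟ᶠ one | i ≟ᶠ chord one | i ≟ᶠ two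
                           | prev i ≟ᶠ chord one
      ... | yes refl | _         | _         | _         | _      = free-zero-bwd
      ... | no _    | yes refl | _         | _         | _      = ⊥-elim (a∉ (here refl))
      ... | no _    | no _    | yes refl | _         | _      = ⊥-elim (a∉ (there (there (there (there (here refl))))))
      ... | no _    | no _    | no _    | yes refl | _      = free-two-bwd
      ... | no i≢0  | no _    | no _    | no _    | yes p = free-bwd-after-chord-one i≢0 p
      ... | no i≢0  | no _    | no _    | no i≢2  | no p = free-bwd i≢0 i≢2 p
      free (i , chd) a∉ with i ≟ᶠ zero | i ≟ᶠ one | i ≟ᶠ chord zero | i ≟ᶠ prev zero
                           | i ≟ᶠ chord one
      ... | yes refl | _         | _         | _         | _         = free-zero-chd
      ... | no _    | yes refl | _         | _         | _         = free-X
      ... | no _    | no _    | yes refl | _         | _         = ⊥-elim (a∉ (there (there (here refl))))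
      ... | no _    | no _    | no _    | yes refl | _         = free-last-chd
      ... | no _    | no _    | no _    | no i≢l  | yes refl = free-chord-one-chd i≢l
      ... | no i≢0  | no i≢1  | no i≢m0 | no _    | no i≢m1 = free-chd i≢0 i≢1 i≢m0 i≢m1

      open Proper keys-unique listed compatible free public

  ProperListColouring : (Arc → List ℕ) → Set
  ProperListColouring L =
    Σ (Arc → ℕ) λ σ → (∀ a → σ a ∈ L a) × (∀ a b → a ≢ b → Conflict a b → σ a ≢ σ b)

  arcs-choosable : ∀ L → (∀ a → UniqueOfLength 6 (L a)) → ProperListColouring L
  arcs-choosable L L-size with chord zero ≟ᶠ two
  ... | yes chord-zero≡two = σ , σ-∈-L , σ-proper
    where open Colouring.ChordToTwo L L-size chord-zero≡two
  ... | no  chord-zero≢two = σ , σ-∈-L , σ-proper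
    where open Colouring.ChordAvoidsTwo L L-size chord-zero≢two

degree-< : ∀ G v → degree G v < n G
degree-< G v = subst (degree G v <_) (length-tabulate id)
  (filter-notAll (λ u → T? (adj G v u)) (allFin (n G)) (Any.map (λ { refl → subst T (irrefl G v) }) (∈-allFin v)))

injective⇒surjective : ∀ {m} {f : Fin m → Fin m} → Injective _≡_ _≡_ f → ∀ y → ∃ λ x → f x ≡ y
injective⇒surjective {m} {f} f-injective y
  with ∈-map⁻ f (Counting.⊆-flip-if-not-longer _≟ᶠ_ (map⁺ f-injective (allFin⁺ m))
                                                 (≤-reflexive (sym (length-map f (allFin m))))
                                       (λ {x} _ → ∈-allFin x) (∈-allFin y))
... | x , _ , refl = x , refl

module HamiltonianCubic {N : ℕ} (adj : Fin (4 + N) → Fin (4 + N) → Bool)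
  (adj-sym : ∀ u v → adj u v ≡ adj v u) (adj-irrefl : ∀ v → adj v v ≡ false) where

  G : Graph
  G = record { n = 4 + N ; adj = adj ; sym = adj-sym ; irrefl = adj-irrefl }

  module _ (cubic : Cubic G) (c : Fin (4 + N) → Fin (4 + N)) (c-injective : Injective _≡_ _≡_ c)
    (c-cycle : ∀ i j → (suc (toℕ i) ≡ toℕ j ⊎ (suc (toℕ i) ≡ 4 + N × toℕ j ≡ 0)) → Edge G (c i) (c j))
    where

    EdgeAt : Fin (4 + N) → Fin (4 + N) → Set
    EdgeAt i j = Edge G (c i) (c j)

    edge-sym : ∀ {u v} → Edge G u v → Edge G v u
    edge-sym {u} {v} = subst T (adj-sym u v)

    edge-next : ∀ i → EdgeAt i (next i)
    edge-next i = c-cycle i (next i) (next-step i)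

    edge-prev : ∀ i → EdgeAt i (prev i)
    edge-prev i = edge-sym (subst (EdgeAt (prev i)) (next-prev i) (edge-next (prev i)))

    opaque
      position : Fin (4 + N) → Fin (4 + N)
      position v = proj₁ (injective⇒surjective c-injective v)

      c-position : ∀ v → c (position v) ≡ v
      c-position v = proj₂ (injective⇒surjective c-injective v)

    position-injective : ∀ {u v} → position u ≡ position v → u ≡ v
    position-injective {u} {v} eq = trans (sym (c-position u)) (trans (cong c eq) (c-position v))

    neighbours : Fin (4 + N) → List (Fin (4 + N))
    neighbours v = filter (λ u → T? (adj v u)) (allFin (4 + N))

    ∈-neighbours⁺ : ∀ {v u} → Edge G v u → u ∈ neighbours v
    ∈-neighbours⁺ {v} {u} = ∈-filter⁺ (λ u → T? (adj v u)) (∈-allFin u)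

    ∈-neighbours⁻ : ∀ {v u} → u ∈ neighbours v → Edge G v u
    ∈-neighbours⁻ {v} = proj₂ ∘ ∈-filter⁻ (λ u → T? (adj v u)) {xs = allFin (4 + N)}

    neighbours-unique : ∀ v → Unique (neighbours v)
    neighbours-unique v = filter⁺ (λ u → T? (adj v u)) (allFin⁺ (4 + N))

    opaque
      third-neighbour : ∀ i → ∃ λ v → Edge G (c i) v × v ∉ c (next i) ∷ c (prev i) ∷ []
      third-neighbour i
        with Counting.pigeonhole _≟ᶠ_ (neighbours-unique (c i))
                                      (subst (2 <_) (sym (cubic (c i))) (s≤s (s≤s (s≤s z≤n))))
      ... | v , v∈ , v∉ = v , ∈-neighbours⁻ v∈ , v∉

    chord : Fin (4 + N) → Fin (4 + N)
    chord i = position (proj₁ (third-neighbour i))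

    c-chord : ∀ i → c (chord i) ≡ proj₁ (third-neighbour i)
    c-chord i = c-position (proj₁ (third-neighbour i))

    edge-chord : ∀ i → EdgeAt i (chord i)
    edge-chord i = subst (Edge G (c i)) (sym (c-chord i)) (proj₁ (proj₂ (third-neighbour i)))

    chord≢next : ∀ i → chord i ≢ next i
    chord≢next i eq = proj₂ (proj₂ (third-neighbour i)) (here (trans (sym (c-chord i)) (cong c eq)))

    chord≢prev : ∀ i → chord i ≢ prev i
    chord≢prev i eq = proj₂ (proj₂ (third-neighbour i)) (there (here (trans (sym (c-chord i)) (cong c eq))))

    chord≢self : ∀ i → chord i ≢ i
    chord≢self i eq = subst T (adj-irrefl (c i)) (subst (EdgeAt i) eq (edge-chord i))

    next≢prev : ∀ i → next i ≢ prev i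
    next≢prev i eq = next-next-≢ {suc N} i (trans (cong next eq) (next-prev i))

    neighbour-cases : ∀ {i j} → EdgeAt i j → j ≡ next i ⊎ j ≡ prev i ⊎ j ≡ chord i
    neighbour-cases {i} {j} e with j ≟ᶠ next i | j ≟ᶠ prev i | j ≟ᶠ chord i
    ... | yes eq | _      | _      = inj₁ eq
    ... | no _   | yes eq | _      = inj₂ (inj₁ eq)
    ... | no _   | no _   | yes eq = inj₂ (inj₂ eq)
    ... | no j≢n | no j≢p | no j≢m =
      contradiction (subst (4 ≤_) (cubic (c i)) (Counting.length-mono-⊆ _≟ᶠ_ four-distinct four⊆))
                    λ { (s≤s (s≤s (s≤s ()))) }
      where
      c≢ : ∀ {k l} → k ≢ l → c k ≢ c l
      c≢ k≢l = k≢l ∘ c-injective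
      four-distinct : Unique (c (next i) ∷ c (prev i) ∷ c (chord i) ∷ c j ∷ [])
      four-distinct = (c≢ (next≢prev i) ∷ c≢ (chord≢next i ∘ sym) ∷ c≢ (j≢n ∘ sym) ∷ [])
                    ∷ (c≢ (chord≢prev i ∘ sym) ∷ c≢ (j≢p ∘ sym) ∷ [])
                    ∷ (c≢ (j≢m ∘ sym) ∷ [])
                    ∷ [] ∷ []
      four⊆ : ∀ {v} → v ∈ c (next i) ∷ c (prev i) ∷ c (chord i) ∷ c j ∷ [] → v ∈ neighbours (c i)
      four⊆ (here refl)                         = ∈-neighbours⁺ (edge-next i)
      four⊆ (there (here refl))                 = ∈-neighbours⁺ (edge-prev i)
      four⊆ (there (there (here refl)))         = ∈-neighbours⁺ (edge-chord i)
      four⊆ (there (there (there (here refl)))) = ∈-neighbours⁺ e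

    chord-involutive : ∀ i → chord (chord i) ≡ i
    chord-involutive i with neighbour-cases (edge-sym (edge-chord i))
    ... | inj₁ i≡next =
      contradiction (trans (sym (prev-next (chord i))) (cong prev (sym i≡next))) (chord≢prev i)
    ... | inj₂ (inj₁ i≡prev) =
      contradiction (trans (sym (next-prev (chord i))) (cong next (sym i≡prev))) (chord≢next i)
    ... | inj₂ (inj₂ i≡chord) = sym i≡chord

    open ChordedCycle N chord chord-involutive chord≢next chord≢prev chord≢self

    edge-tgt : ∀ a → EdgeAt (proj₁ a) (tgt a)
    edge-tgt (i , fwd) = edge-next i
    edge-tgt (i , bwd) = edge-prev i
    edge-tgt (i , chd) = edge-chord i

    incidence : Arc → Incidence G
    incidence a = inc (c (proj₁ a)) (c (tgt a)) (edge-tgt a)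

    direction : ∀ {i j} → j ≡ next i ⊎ j ≡ prev i ⊎ j ≡ chord i → Dir
    direction (inj₁ _)        = fwd
    direction (inj₂ (inj₁ _)) = bwd
    direction (inj₂ (inj₂ _)) = chd

    tgt-direction : ∀ {i j} (cases : j ≡ next i ⊎ j ≡ prev i ⊎ j ≡ chord i) → tgt (i , direction cases) ≡ j
    tgt-direction (inj₁ eq)        = sym eq
    tgt-direction (inj₂ (inj₁ eq)) = sym eq
    tgt-direction (inj₂ (inj₂ eq)) = sym eq

    edge-position : ∀ {v u} → Edge G v u → EdgeAt (position v) (position u)
    edge-position {v} {u} = subst₂ (Edge G) (sym (c-position v)) (sym (c-position u))

    arc : Incidence G → Arc
    arc (inc v u e) = position v , direction (neighbour-cases (edge-position e))

    tgt-arc : ∀ ι → tgt (arc ι) ≡ position (other ι)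
    tgt-arc (inc v u e) = tgt-direction (neighbour-cases (edge-position e))

    incidence-arc : ∀ ι → incidence (arc ι) ≡ ι
    incidence-arc ι@(inc v u e) = inc-≡ (c-position v) (trans (cong c (tgt-arc ι)) (c-position u))
      where
      inc-≡ : ∀ {v′ u′} {e′ : Edge G v′ u′} → v′ ≡ v → u′ ≡ u → inc v′ u′ e′ ≡ inc v u e
      inc-≡ refl refl = cong (inc v u) (T-irrelevant _ e)

    arc-conflict : ∀ ι ι′ → AdjInc G ι ι′ → arc ι ≢ arc ι′ × Conflict (arc ι) (arc ι′)
    arc-conflict ι@(inc v u _) ι′@(inc w x _) (distinct , adjacent) = arc≢arc′ , conflict adjacent
      where
      arc≢arc′ : arc ι ≢ arc ι′
      arc≢arc′ eq = distinct (position-injective (cong proj₁ eq)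
                             , position-injective (trans (sym (tgt-arc ι)) (trans (cong tgt eq) (tgt-arc ι′))))
      conflict : v ≡ w ⊎ (v ≡ x × u ≡ w) ⊎ w ≡ u ⊎ x ≡ v → Conflict (arc ι) (arc ι′)
      conflict (inj₁ v≡w)               = same-src (cong position v≡w)
      conflict (inj₂ (inj₁ (_ , u≡w)))  = tgt-src (trans (tgt-arc ι) (cong position u≡w))
      conflict (inj₂ (inj₂ (inj₁ w≡u))) = tgt-src (trans (tgt-arc ι) (cong position (sym w≡u)))
      conflict (inj₂ (inj₂ (inj₂ x≡v))) = src-tgt (trans (tgt-arc ι′) (cong position x≡v))

    choosable : IncidenceChoosable G 6
    choosable L L-size with arcs-choosable (L ∘ incidence) (L-size ∘ incidence)
    ... | σ , σ-∈-L , σ-proper =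
      σ ∘ arc ,
      (λ ι → subst (λ ι′ → σ (arc ι) ∈ L ι′) (incidence-arc ι) (σ-∈-L (arc ι))) ,
      (λ ι ι′ adjacent → let arc≢arc′ , conflict = arc-conflict ι ι′ adjacent
                         in σ-proper (arc ι) (arc ι′) arc≢arc′ conflict)

theorem18 : (G : Graph) → Cubic G → Hamiltonian G → ChI≤ G 6
theorem18 record { n = zero } _ (() , _)
theorem18 record { n = suc zero } _ (s≤s () , _)
theorem18 record { n = suc (suc zero) } _ (s≤s (s≤s ()) , _)
theorem18 G@record { n = suc (suc (suc zero)) } cubic _ =
  contradiction (subst (_< 3) (cubic zero) (degree-< G zero)) λ { (s≤s (s≤s (s≤s ()))) }
theorem18 record { n = suc (suc (suc (suc N))) ; adj = adj ; sym = adj-sym ; irrefl = adj-irrefl }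
          cubic (_ , c , c-injective , c-cycle) =
  6 , ≤-refl , HamiltonianCubic.choosable adj adj-sym adj-irrefl cubic c c-injective c-cycle
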